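{- Let $n\equiv 0\pmod 4$ with $n\geq 8$. Then there exists an $\mathrm{SH}^*(n;7)$.
   Context: An $\mathrm{H}(n;k)$ is an $n\times n$ partially filled array with entries in $\{\pm1,\dots,\pm nk\}\subset\mathbb{Z}$ such that no two entries agree in absolute value, each row and each column has exactly $k$ filled cells, and every row and every column sums to $0$ in $\mathbb{Z}$. An ordering $(a_1,\dots,a_k)$ is simple modulo $v$ if its partial sums $s_i=\sum_{j\le i}a_j$ are pairwise distinct modulo $v$. An $\mathrm{SH}^*(n;k)$ is an $\mathrm{H}(n;k)$ in which the natural ordering of each row (left to right, skipping empty cells) and each column (top to bottom, skipping empty cells) is simple both modulo $2nk+1$ and modulo $2nk+2$. -}

module Defs where

open import Data.Nat using (ℕ; zero; suc; _*_; _≤_)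
import Data.Nat
open import Data.Integer as ℤ using (ℤ; ∣_∣)
open import Data.Integer.DivMod using (_%ℕ_)
open import Data.Fin using (Fin)
open import Data.Maybe using (Maybe; just; nothing; is-just)
open import Data.List using (List; []; _∷_; length; mapMaybe; map; foldr)
open import Data.List.Relation.Unary.Unique.Propositional using (Unique)
open import Data.Vec.Functional using (Vector)
open import Data.Fin.Base using ()
open import Data.List.Base using ()
open import Data.Product using (_×_)
open import Relation.Binary.PropositionalEquality using (_≡_)
open import Data.List using (allFin)

-- A partially filled n×n array with integer entries: nothing = empty cell.
PArray : ℕ → Set
PArray n = Fin n → Fin n → Maybe ℤ

row : ∀ {n} → PArray n → Fin n → List ℤ
row {n} A i = mapMaybe (λ j → A i j) (allFin n)

col : ∀ {n} → PArray n → Fin n → List ℤ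
col {n} A j = mapMaybe (λ i → A i j) (allFin n)

partialSums : List ℤ → List ℤ
partialSums [] = []
partialSums (a ∷ as) = a ∷ map (λ s → a ℤ.+ s) (partialSums as)

sumℤ : List ℤ → ℤ
sumℤ = foldr ℤ._+_ (ℤ.+ 0)

SimpleMod : (v : ℕ) → .{{_ : Data.Nat.NonZero v}} → List ℤ → Set
SimpleMod v xs = Unique (map (λ s → s %ℕ v) (partialSums xs))

record IsH (n k : ℕ) (A : PArray n) : Set where
  field
    entryRange : ∀ i j a → A i j ≡ just a → 1 ≤ ∣ a ∣ × ∣ a ∣ ≤ n * k
    absDistinct : ∀ i j i' j' a b → A i j ≡ just a → A i' j' ≡ just b →
                  ∣ a ∣ ≡ ∣ b ∣ → (i ≡ i' × j ≡ j')
    rowCount : ∀ i → length (row A i) ≡ k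
    colCount : ∀ j → length (col A j) ≡ k
    rowSum : ∀ i → sumℤ (row A i) ≡ ℤ.+ 0
    colSum : ∀ j → sumℤ (col A j) ≡ ℤ.+ 0

record IsSHStar (n k : ℕ) (A : PArray n) : Set where
  field
    isH : IsH n k A
    rowSimple₁ : ∀ i → SimpleMod (suc (2 * n * k)) (row A i)
    rowSimple₂ : ∀ i → SimpleMod (suc (suc (2 * n * k))) (row A i)
    colSimple₁ : ∀ j → SimpleMod (suc (2 * n * k)) (col A j)
    colSimple₂ : ∀ j → SimpleMod (suc (suc (2 * n * k))) (col A j)

module Submission where

open import Defs
open import Data.Bool using (if_then_else_)
open import Data.Empty using (⊥)
open import Data.Fin as Fin
  using (Fin; zero; suc; toℕ; _↑ˡ_; _↑ʳ_; combine; remQuot; quotient; remainder; fromℕ; inject₁)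
open import Data.Fin.Patterns using (0F; 1F; 2F; 3F)
open import Data.Fin.Properties
  using (all?; suc-injective; toℕ-injective; toℕ<n; toℕ-fromℕ; toℕ-inject₁; remQuot-combine; combine-remQuot)
  renaming (_≟_ to _≟ᶠ_)
open import Data.Fin.Relation.Unary.Top using (view; ‵fromℕ; ‵inj₁)
open import Data.Integer as ℤ using (ℤ; +_; 0ℤ; ∣_∣)
import Data.Integer.Properties as ℤ
open import Data.List
  using (List; []; _∷_; _++_; concat; map; foldr; length; tabulate; catMaybes; allFin; find; cartesianProduct)
open import Data.List.Properties
  using (catMaybes-++; map-catMaybes; map-tabulate; tabulate-cong; ++-identityʳ; map-++; map-∘; map-cong; length-map)
open import Data.List.Relation.Unary.AllPairs as AllPairs using (AllPairs; allPairs?)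
import Data.List.Relation.Unary.AllPairs.Properties as AllPairs
open import Data.List.Relation.Unary.Unique.Propositional using (Unique)
open import Data.Maybe as Maybe using (Maybe; just; nothing; _>>=_)
import Data.Maybe.Properties as Maybe
open import Data.Maybe.Relation.Unary.All as AllMaybe using (just) renaming (All to AllMaybe)
open import Data.Nat as ℕ using (ℕ; zero; suc)
import Data.Nat.Properties as ℕ
open import Data.Product using (Σ; _×_; _,_; proj₁; proj₂; uncurry)
import Data.Product.Properties as Product
open import Data.Sign as Sign using (Sign)
open import Data.Sum using (_⊎_; inj₁; inj₂)
open import Function using (_∘_)
open import Relation.Binary.Definitions using (DecidableEquality)
open import Relation.Binary.PropositionalEquality
open import Relation.Nullary using (¬_; Dec; yes; no; does; ¬?; contradiction)
open import Relation.Nullary.Decidable using (_×-dec_; _⊎-dec_; dec-true; dec-false; from-yes)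
open import Relation.Unary using (Decidable)

-- Write n = 4m. The array consists of m × m blocks of size 4: the diagonal block (Q, Q) is a
-- full 4 × 4 pattern D and the block (Q, Q + 1 mod m) a pattern E with empty diagonal, so every
-- row and column has 4 + 3 = 7 entries. An entry in block row q is ±(14 (a q + b r) + c) with
-- r = m − 1 − q, where the sign, (a, b) and the residue c depend only on its place in D or E.
--
-- Every row and column is obtained, for some ρ ∈ Fin 4 and some X, Y with m = X + Y + 2, by
-- evaluating at (X, Y) one of four lists of forms 14 (x X + y Y) + c. A finite computation shows
-- that each list sums to the zero form and that the difference d of any two of its partial sums
-- is nonzero everywhere while 2nk ± d, with 2nk = 56 (X + Y + 2), has nonnegative coefficients.
-- Hence 0 < |d| ≤ 2nk, so the partial sums are distinct modulo 2nk + 1 and modulo 2nk + 2.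
--
-- Absolute values are distinct because a magnitude determines c and q (through its residues and
-- quotients modulo 14 and 28), c determines the place in D or E, and q the block.

-- Integer forms and certified lines

module Forms where

  open import Data.Integer using (-[1+_]; +[1+_]; _+_; _-_; -_; _*_; _≤_; _<_; _%ℕ_; +≤+; +<+)
  open import Data.Integer.DivMod using (_/ℕ_; a≡a%ℕn+[a/ℕn]*n)
  open import Data.Integer.Properties
  open import Data.Integer.Tactic.RingSolver using (solve-∀)
  open import Data.Nat.Divisibility using (_∣_; _∣?_; divides; n∣m⇒m%n≡0)
  open import Data.Nat.DivMod using (m<n⇒m%n≡m)

  record Form : Set where
    constructor form
    field x y c : ℤ

  ⟦_⟧ : Form → ℕ → ℕ → ℤ
  ⟦ form x y c ⟧ X Y = + 14 * (x * + X + y * + Y) + c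

  infixl 6 _⊕_ _⊝_

  _⊕_ : Form → Form → Form
  form x y c ⊕ form x′ y′ c′ = form (x + x′) (y + y′) (c + c′)

  ⊝_ : Form → Form
  ⊝ form x y c = form (- x) (- y) (- c)

  _⊝_ : Form → Form → Form
  f ⊝ g = f ⊕ ⊝ g

  𝟎 : Form
  𝟎 = form 0ℤ 0ℤ 0ℤ

  ⟦⟧-⊕ : ∀ f g X Y → ⟦ f ⊕ g ⟧ X Y ≡ ⟦ f ⟧ X Y + ⟦ g ⟧ X Y
  ⟦⟧-⊕ (form x y c) (form x′ y′ c′) X Y = identity x y c x′ y′ c′ (+ X) (+ Y)
    where
    identity : ∀ x y c x′ y′ c′ X Y → + 14 * ((x + x′) * X + (y + y′) * Y) + (c + c′)
                                       ≡ (+ 14 * (x * X + y * Y) + c) + (+ 14 * (x′ * X + y′ * Y) + c′)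
    identity = solve-∀

  ⟦⟧-⊝ : ∀ f X Y → ⟦ ⊝ f ⟧ X Y ≡ - ⟦ f ⟧ X Y
  ⟦⟧-⊝ (form x y c) X Y = identity x y c (+ X) (+ Y)
    where
    identity : ∀ x y c X Y → + 14 * (- x * X + - y * Y) + - c ≡ - (+ 14 * (x * X + y * Y) + c)
    identity = solve-∀

  ⟦⟧-𝟎 : ∀ X Y → ⟦ 𝟎 ⟧ X Y ≡ 0ℤ
  ⟦⟧-𝟎 X Y = identity (+ X) (+ Y)
    where
    identity : ∀ X Y → + 14 * (0ℤ * X + 0ℤ * Y) + 0ℤ ≡ 0ℤ
    identity = solve-∀

  ⟦⟧-minus : ∀ f g X Y → ⟦ f ⊝ g ⟧ X Y ≡ ⟦ f ⟧ X Y - ⟦ g ⟧ X Y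
  ⟦⟧-minus f g X Y = trans (⟦⟧-⊕ f (⊝ g) X Y) (cong (λ t → ⟦ f ⟧ X Y + t) (⟦⟧-⊝ g X Y))

  ⟦⟧-ℕ : ∀ x y c X Y → ⟦ form (+ x) (+ y) (+ c) ⟧ X Y ≡ + (14 ℕ.* (x ℕ.* X ℕ.+ y ℕ.* Y) ℕ.+ c)
  ⟦⟧-ℕ x y c X Y = sym (begin
    + (14 ℕ.* (x ℕ.* X ℕ.+ y ℕ.* Y) ℕ.+ c)        ≡⟨ pos-+ (14 ℕ.* (x ℕ.* X ℕ.+ y ℕ.* Y)) c ⟩
    + (14 ℕ.* (x ℕ.* X ℕ.+ y ℕ.* Y)) + + c        ≡⟨ cong (_+ + c) (pos-* 14 (x ℕ.* X ℕ.+ y ℕ.* Y)) ⟩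
    + 14 * + (x ℕ.* X ℕ.+ y ℕ.* Y) + + c          ≡⟨ cong (λ t → + 14 * t + + c) (pos-+ (x ℕ.* X) (y ℕ.* Y)) ⟩
    + 14 * (+ (x ℕ.* X) + + (y ℕ.* Y)) + + c      ≡⟨ cong₂ (λ s t → + 14 * (s + t) + + c) (pos-* x X) (pos-* y Y) ⟩
    + 14 * (+ x * + X + + y * + Y) + + c          ∎)
    where open ≡-Reasoning

  NonNeg : Form → Set
  NonNeg (form x y c) = 0ℤ ≤ x × 0ℤ ≤ y × 0ℤ ≤ c

  nonNeg? : Decidable NonNeg
  nonNeg? (form x y c) = (0ℤ ≤? x) ×-dec (0ℤ ≤? y) ×-dec (0ℤ ≤? c)

  ⟦⟧-nonNeg : ∀ f X Y → NonNeg f → 0ℤ ≤ ⟦ f ⟧ X Y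
  ⟦⟧-nonNeg (form (+ x) (+ y) (+ c)) X Y (+≤+ _ , +≤+ _ , +≤+ _) =
    subst (0ℤ ≤_) (sym (⟦⟧-ℕ x y c X Y)) (+≤+ ℕ.z≤n)

  infix 4 _≼_

  _≼_ : Form → Form → Set
  f ≼ g = NonNeg (g ⊝ f)

  ≼-sound : ∀ f g X Y → f ≼ g → ⟦ f ⟧ X Y ≤ ⟦ g ⟧ X Y
  ≼-sound f g X Y f≼g = 0≤i-j⇒j≤i (subst (0ℤ ≤_) (⟦⟧-minus g f X Y) (⟦⟧-nonNeg (g ⊝ f) X Y f≼g))

  Positive : Form → Set
  Positive f = NonNeg f × 0ℤ < Form.c f

  -- The first disjunct works because 14 divides every value of a form with constant term 0.
  Apart : Form → Set
  Apart f = ¬ (14 ∣ ∣ Form.c f ∣) ⊎ Positive f ⊎ Positive (⊝ f)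

  apart? : Decidable Apart
  apart? f = ¬? (14 ∣? ∣ Form.c f ∣) ⊎-dec (positive? f ⊎-dec positive? (⊝ f))
    where
    positive? : Decidable Positive
    positive? f = nonNeg? f ×-dec (0ℤ <? Form.c f)

  ⟦⟧-positive : ∀ f X Y → Positive f → ⟦ f ⟧ X Y ≢ 0ℤ
  ⟦⟧-positive (form (+ x) (+ y) +[1+ c ]) X Y ((+≤+ _ , +≤+ _ , _) , _) eq =
    ℕ.m+1+n≢0 (14 ℕ.* (x ℕ.* X ℕ.+ y ℕ.* Y)) (+-injective (trans (sym (⟦⟧-ℕ x y (ℕ.suc c) X Y)) eq))
  ⟦⟧-positive (form (+ x) (+ y) (+ 0)) X Y (_ , +<+ ())

  ⟦⟧≡0⇒14∣c : ∀ f X Y → ⟦ f ⟧ X Y ≡ 0ℤ → 14 ∣ ∣ Form.c f ∣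
  ⟦⟧≡0⇒14∣c (form x y c) X Y eq = divides ∣ t ∣ (begin
    ∣ c ∣             ≡⟨ cong ∣_∣ c≡-14t ⟩
    ∣ - (+ 14 * t) ∣  ≡⟨ ∣-i∣≡∣i∣ (+ 14 * t) ⟩
    ∣ + 14 * t ∣      ≡⟨ abs-* (+ 14) t ⟩
    14 ℕ.* ∣ t ∣      ≡⟨ ℕ.*-comm 14 ∣ t ∣ ⟩
    ∣ t ∣ ℕ.* 14      ∎)
    where
    open ≡-Reasoning
    t = x * + X + y * + Y
    c≡-14t : c ≡ - (+ 14 * t)
    c≡-14t = trans (sym (identity (+ 14 * t) c)) (trans (cong (_- + 14 * t) eq) (+-identityˡ _))
      where
      identity : ∀ s c → s + c - s ≡ c
      identity = solve-∀

  ⟦⟧-apart : ∀ f X Y → Apart f → ⟦ f ⟧ X Y ≢ 0ℤ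
  ⟦⟧-apart f X Y (inj₁ 14∤c)        eq = 14∤c (⟦⟧≡0⇒14∣c f X Y eq)
  ⟦⟧-apart f X Y (inj₂ (inj₁ pos))  eq = ⟦⟧-positive f X Y pos eq
  ⟦⟧-apart f X Y (inj₂ (inj₂ pos))  eq = ⟦⟧-positive (⊝ f) X Y pos (trans (⟦⟧-⊝ f X Y) (cong -_ eq))

  ∣i∣≤n : ∀ {n} i → i ≤ + n → - i ≤ + n → ∣ i ∣ ℕ.≤ n
  ∣i∣≤n (+ _)     i≤n  _    = drop‿+≤+ i≤n
  ∣i∣≤n -[1+ _ ]  _    -i≤n = drop‿+≤+ -i≤n

  i-j≡[i/v-j/v]*v : ∀ i j v .{{_ : ℕ.NonZero v}} → i %ℕ v ≡ j %ℕ v →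
                    i - j ≡ (i /ℕ v - j /ℕ v) * + v
  i-j≡[i/v-j/v]*v i j v same-residue = begin
    i - j
      ≡⟨ cong₂ _-_ (a≡a%ℕn+[a/ℕn]*n i v) (a≡a%ℕn+[a/ℕn]*n j v) ⟩
    (+ (i %ℕ v) + i /ℕ v * + v) - (+ (j %ℕ v) + j /ℕ v * + v)
      ≡⟨ cong (λ r → (+ (i %ℕ v) + i /ℕ v * + v) - (+ r + j /ℕ v * + v)) (sym same-residue) ⟩
    (+ (i %ℕ v) + i /ℕ v * + v) - (+ (i %ℕ v) + j /ℕ v * + v)
      ≡⟨ identity (+ (i %ℕ v)) (i /ℕ v) (j /ℕ v) (+ v) ⟩
    (i /ℕ v - j /ℕ v) * + v ∎
    where
    open ≡-Reasoning
    identity : ∀ r a b v → (r + a * v) - (r + b * v) ≡ (a - b) * v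
    identity = solve-∀

  %ℕ-injective : ∀ i j v .{{_ : ℕ.NonZero v}} → i %ℕ v ≡ j %ℕ v → ∣ i - j ∣ ℕ.< v → i ≡ j
  %ℕ-injective i j v same-residue small = i-j≡0⇒i≡j i j (∣i∣≡0⇒i≡0 (begin
    ∣ i - j ∣          ≡⟨ m<n⇒m%n≡m small ⟨
    ∣ i - j ∣ ℕ.% v    ≡⟨ n∣m⇒m%n≡0 ∣ i - j ∣ v v∣i-j ⟩
    0                  ∎))
    where
    open ≡-Reasoning
    v∣i-j : v ∣ ∣ i - j ∣
    v∣i-j = divides ∣ i /ℕ v - j /ℕ v ∣
      (trans (cong ∣_∣ (i-j≡[i/v-j/v]*v i j v same-residue)) (abs-* (i /ℕ v - j /ℕ v) (+ v)))

  Separated : Form → Form → Form → Set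
  Separated M f g = g ⊝ f ≼ M × ⊝ (g ⊝ f) ≼ M × Apart (g ⊝ f)

  separated? : ∀ M f g → Dec (Separated M f g)
  separated? M f g = nonNeg? (M ⊝ (g ⊝ f)) ×-dec nonNeg? (M ⊝ ⊝ (g ⊝ f)) ×-dec apart? (g ⊝ f)

  separated⇒%ℕ≢ : ∀ M f g X Y {B v} .{{_ : ℕ.NonZero v}} → ⟦ M ⟧ X Y ≡ + B → B ℕ.< v →
                  Separated M f g → ⟦ f ⟧ X Y %ℕ v ≢ ⟦ g ⟧ X Y %ℕ v
  separated⇒%ℕ≢ M f g X Y {B} {v} M≡B B<v (d≼M , -d≼M , apart) same-residue =
    ⟦⟧-apart d X Y apart (trans (⟦⟧-minus g f X Y) (i≡j⇒i-j≡0 (sym f≡g)))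
    where
    d = g ⊝ f
    bound : ⟦ d ⟧ X Y ≤ + B
    bound = subst (⟦ d ⟧ X Y ≤_) M≡B (≼-sound d M X Y d≼M)
    bound′ : - ⟦ d ⟧ X Y ≤ + B
    bound′ = subst₂ _≤_ (⟦⟧-⊝ d X Y) M≡B (≼-sound (⊝ d) M X Y -d≼M)
    close : ∣ ⟦ f ⟧ X Y - ⟦ g ⟧ X Y ∣ ℕ.< v
    close = begin-strict
      ∣ ⟦ f ⟧ X Y - ⟦ g ⟧ X Y ∣  ≡⟨ ∣i-j∣≡∣j-i∣ (⟦ f ⟧ X Y) (⟦ g ⟧ X Y) ⟩
      ∣ ⟦ g ⟧ X Y - ⟦ f ⟧ X Y ∣  ≡⟨ cong ∣_∣ (⟦⟧-minus g f X Y) ⟨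
      ∣ ⟦ d ⟧ X Y ∣              ≤⟨ ∣i∣≤n (⟦ d ⟧ X Y) bound bound′ ⟩
      B                          <⟨ B<v ⟩
      v                          ∎
      where open ℕ.≤-Reasoning
    f≡g : ⟦ f ⟧ X Y ≡ ⟦ g ⟧ X Y
    f≡g = %ℕ-injective (⟦ f ⟧ X Y) (⟦ g ⟧ X Y) v same-residue close

  partialSumsᶠ : List Form → List Form
  partialSumsᶠ []       = []
  partialSumsᶠ (f ∷ fs) = f ∷ map (f ⊕_) (partialSumsᶠ fs)

  sumᶠ : List Form → Form
  sumᶠ = foldr _⊕_ 𝟎

  IsZero : Form → Set
  IsZero (form x y c) = x ≡ 0ℤ × y ≡ 0ℤ × c ≡ 0ℤ

  Certified : Form → List Form → Set
  Certified M fs = IsZero (sumᶠ fs) × AllPairs (Separated M) (partialSumsᶠ fs)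

  certified? : ∀ M fs → Dec (Certified M fs)
  certified? M fs = isZero? (sumᶠ fs) ×-dec allPairs? (separated? M) (partialSumsᶠ fs)
    where
    isZero? : Decidable IsZero
    isZero? (form x y c) = (x ≟ 0ℤ) ×-dec (y ≟ 0ℤ) ×-dec (c ≟ 0ℤ)

  values : List Form → ℕ → ℕ → List ℤ
  values fs X Y = map (λ f → ⟦ f ⟧ X Y) fs

  partialSums-values : ∀ fs X Y → partialSums (values fs X Y) ≡ values (partialSumsᶠ fs) X Y
  partialSums-values []       X Y = refl
  partialSums-values (f ∷ fs) X Y = cong (⟦ f ⟧ X Y ∷_) (begin
    map (λ s → ⟦ f ⟧ X Y + s) (partialSums (values fs X Y))
      ≡⟨ cong (map (λ s → ⟦ f ⟧ X Y + s)) (partialSums-values fs X Y) ⟩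
    map (λ s → ⟦ f ⟧ X Y + s) (values (partialSumsᶠ fs) X Y)
      ≡⟨ map-∘ (partialSumsᶠ fs) ⟨
    map (λ g → ⟦ f ⟧ X Y + ⟦ g ⟧ X Y) (partialSumsᶠ fs)
      ≡⟨ map-cong (λ g → sym (⟦⟧-⊕ f g X Y)) (partialSumsᶠ fs) ⟩
    map (λ g → ⟦ f ⊕ g ⟧ X Y) (partialSumsᶠ fs)
      ≡⟨ map-∘ (partialSumsᶠ fs) ⟩
    values (map (f ⊕_) (partialSumsᶠ fs)) X Y ∎)
    where open ≡-Reasoning

  sumℤ-values : ∀ fs X Y → sumℤ (values fs X Y) ≡ ⟦ sumᶠ fs ⟧ X Y
  sumℤ-values []       X Y = sym (⟦⟧-𝟎 X Y)
  sumℤ-values (f ∷ fs) X Y =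
    trans (cong (λ s → ⟦ f ⟧ X Y + s) (sumℤ-values fs X Y)) (sym (⟦⟧-⊕ f (sumᶠ fs) X Y))

  certified⇒sum≡0 : ∀ M fs X Y → Certified M fs → sumℤ (values fs X Y) ≡ 0ℤ
  certified⇒sum≡0 M fs X Y (isZero , _) = trans (sumℤ-values fs X Y) (⟦⟧-zero (sumᶠ fs) isZero)
    where
    ⟦⟧-zero : ∀ f → IsZero f → ⟦ f ⟧ X Y ≡ 0ℤ
    ⟦⟧-zero (form _ _ _) (refl , refl , refl) = ⟦⟧-𝟎 X Y

  certified⇒simple : ∀ M fs X Y {B} v .{{_ : ℕ.NonZero v}} → ⟦ M ⟧ X Y ≡ + B → B ℕ.< v →
                     Certified M fs → SimpleMod v (values fs X Y)
  certified⇒simple M fs X Y v M≡B B<v (_ , separated) =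
    subst (λ ss → Unique (map (_%ℕ v) ss)) (sym (partialSums-values fs X Y))
      (subst Unique (map-∘ (partialSumsᶠ fs))
        (AllPairs.map⁺ (AllPairs.map (λ {f} {g} → separated⇒%ℕ≢ M f g X Y M≡B B<v) separated)))

open Forms

open import Data.Nat using (_+_; _*_; _∸_; _<_; _≤_; _≟_; _<?_; _≤?_; s≤s; z≤n; z<s; NonZero)
open import Data.Nat.Divisibility using (_∣_; divides; divides-refl)
open import Data.Nat.DivMod using (_%_; _/_; [m+kn]%n≡m%n; m<n⇒m%n≡m; +-distrib-/-∣ʳ; m<n⇒m/n≡0; m*n/n≡m)
open import Data.Nat.Tactic.RingSolver using (solve-∀)
open import Data.List.Membership.DecPropositional _≟_ using (_∈_; _∉_; _∈?_)

-- Filled cells of a tabulated family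

private variable A : Set

tabulate-++ : ∀ a b (g : Fin (a + b) → A) →
              tabulate g ≡ tabulate (g ∘ (_↑ˡ b)) ++ tabulate (g ∘ (a ↑ʳ_))
tabulate-++ zero    b g = refl
tabulate-++ (suc a) b g = cong (g zero ∷_) (tabulate-++ a b (g ∘ suc))

tabulate-combine : ∀ m k (g : Fin (m * k) → A) →
                   tabulate g ≡ concat (tabulate λ (i : Fin m) → tabulate λ (j : Fin k) → g (combine i j))
tabulate-combine zero    k g = refl
tabulate-combine (suc m) k g =
  trans (tabulate-++ k (m * k) g) (cong (tabulate (g ∘ (_↑ˡ m * k)) ++_) (tabulate-combine m k (g ∘ (k ↑ʳ_))))

catMaybes-concat : (xss : List (List (Maybe A))) → catMaybes (concat xss) ≡ concat (map catMaybes xss)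
catMaybes-concat []         = refl
catMaybes-concat (xs ∷ xss) = trans (catMaybes-++ xs (concat xss)) (cong (catMaybes xs ++_) (catMaybes-concat xss))

catMaybes-tabulate-combine : ∀ m k (g : Fin (m * k) → Maybe A) →
  catMaybes (tabulate g) ≡ concat (tabulate λ (i : Fin m) → catMaybes (tabulate λ (j : Fin k) → g (combine i j)))
catMaybes-tabulate-combine m k g = begin
  catMaybes (tabulate g)                    ≡⟨ cong catMaybes (tabulate-combine m k g) ⟩
  catMaybes (concat (tabulate blocks))      ≡⟨ catMaybes-concat (tabulate blocks) ⟩
  concat (map catMaybes (tabulate blocks))  ≡⟨ cong concat (map-tabulate blocks catMaybes) ⟩
  concat (tabulate (catMaybes ∘ blocks))    ∎
  where
  open ≡-Reasoning
  blocks : Fin m → List (Maybe _)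
  blocks i = tabulate λ (j : Fin k) → g (combine i j)

concat-tabulate-[] : ∀ {m} (h : Fin m → List A) → (∀ z → h z ≡ []) → concat (tabulate h) ≡ []
concat-tabulate-[] {m = zero}  h h≡[] = refl
concat-tabulate-[] {m = suc m} h h≡[] rewrite h≡[] zero = concat-tabulate-[] (h ∘ suc) (h≡[] ∘ suc)

concat-tabulate-single : ∀ {m} (h : Fin m → List A) x →
  (∀ z → z ≢ x → h z ≡ []) → concat (tabulate h) ≡ h x
concat-tabulate-single h zero h≡[]
  rewrite concat-tabulate-[] (h ∘ suc) (λ z → h≡[] (suc z) λ ()) = ++-identityʳ (h zero)
concat-tabulate-single h (suc x) h≡[] rewrite h≡[] zero (λ ()) =
  concat-tabulate-single (h ∘ suc) x (λ z z≢x → h≡[] (suc z) (z≢x ∘ suc-injective))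

concat-tabulate-pair : ∀ {m} (h : Fin m → List A) {x y} → x Fin.< y →
  (∀ z → z ≢ x → z ≢ y → h z ≡ []) → concat (tabulate h) ≡ h x ++ h y
concat-tabulate-pair h {zero} {suc y} _ h≡[] =
  cong (h zero ++_) (concat-tabulate-single (h ∘ suc) y
    (λ z z≢y → h≡[] (suc z) (λ ()) (z≢y ∘ suc-injective)))
concat-tabulate-pair h {suc x} {suc y} (s≤s x<y) h≡[] rewrite h≡[] zero (λ ()) (λ ()) =
  concat-tabulate-pair (h ∘ suc) x<y
    (λ z z≢x z≢y → h≡[] (suc z) (z≢x ∘ suc-injective) (z≢y ∘ suc-injective))

-- The construction

data Family : Set where
  twoQ twoR oneQ twoQ+R : Family

coeffQ coeffR : Family → ℕ
coeffQ twoQ   = 2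
coeffQ twoR   = 0
coeffQ oneQ   = 1
coeffQ twoQ+R = 2
coeffR twoQ   = 0
coeffR twoR   = 2
coeffR oneQ   = 0
coeffR twoQ+R = 1

record Entry : Set where
  constructor entry
  field
    sign    : Sign
    family  : Family
    residue : ℕ

magnitude : Entry → ℕ → ℕ → ℕ
magnitude (entry _ f c) q r = 14 * (coeffQ f * q + coeffR f * r) + c

value : Entry → ℕ → ℕ → ℤ
value e q r = Entry.sign e ℤ.◃ magnitude e q r

data BlockKind : Set where
  diag next : BlockKind

diagEntry : Fin 4 → Fin 4 → Entry
diagEntry 0F 0F = entry Sign.- twoQ+R 27
diagEntry 0F 1F = entry Sign.+ twoR   12
diagEntry 0F 2F = entry Sign.- twoR   11
diagEntry 0F 3F = entry Sign.+ twoQ+R 23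
diagEntry 1F 0F = entry Sign.+ twoQ+R 17
diagEntry 1F 1F = entry Sign.- twoQ+R 16
diagEntry 1F 2F = entry Sign.+ twoR    1
diagEntry 1F 3F = entry Sign.- twoR   22
diagEntry 2F 0F = entry Sign.- twoR   15
diagEntry 2F 1F = entry Sign.+ twoQ+R 21
diagEntry 2F 2F = entry Sign.- twoQ+R 18
diagEntry 2F 3F = entry Sign.+ twoR    8
diagEntry 3F 0F = entry Sign.+ twoR   10
diagEntry 3F 1F = entry Sign.- twoR   25
diagEntry 3F 2F = entry Sign.+ twoQ+R 19
diagEntry 3F 3F = entry Sign.- twoQ+R 20

nextEntry : Fin 4 → Fin 4 → Maybe Entry
nextEntry 0F 1F = just (entry Sign.- oneQ  7)
nextEntry 0F 2F = just (entry Sign.+ twoQ 14)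
nextEntry 0F 3F = just (entry Sign.- oneQ  4)
nextEntry 1F 0F = just (entry Sign.- oneQ  6)
nextEntry 1F 2F = just (entry Sign.- oneQ  2)
nextEntry 1F 3F = just (entry Sign.+ twoQ 28)
nextEntry 2F 0F = just (entry Sign.+ twoQ 26)
nextEntry 2F 1F = just (entry Sign.- oneQ  9)
nextEntry 2F 3F = just (entry Sign.- oneQ 13)
nextEntry 3F 0F = just (entry Sign.- oneQ  5)
nextEntry 3F 1F = just (entry Sign.+ twoQ 24)
nextEntry 3F 2F = just (entry Sign.- oneQ  3)
nextEntry _  _  = nothing

blockEntry : BlockKind → Fin 4 → Fin 4 → Maybe Entry
blockEntry diag ρ π = just (diagEntry ρ π)
blockEntry next ρ π = nextEntry ρ π

rowOf colOf : BlockKind → Fin 4 → List Entry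
rowOf k ρ = catMaybes (tabulate (blockEntry k ρ))
colOf k π = catMaybes (tabulate λ ρ → blockEntry k ρ π)

Next : ℕ → ℕ → ℕ → Set
Next m q p = suc q ≡ p ⊎ suc q ≡ m × p ≡ 0

next? : ∀ m q p → Dec (Next m q p)
next? m q p = (suc q ≟ p) ⊎-dec ((suc q ≟ m) ×-dec (p ≟ 0))

Next-functional : ∀ {m q p p′} → p < m → p′ < m → Next m q p → Next m q p′ → p ≡ p′
Next-functional _   _    (inj₁ refl)       (inj₁ refl)       = refl
Next-functional p<m _    (inj₁ refl)       (inj₂ (refl , _)) = contradiction p<m (ℕ.<-irrefl refl)
Next-functional _   p′<m (inj₂ (refl , _)) (inj₁ refl)       = contradiction p′<m (ℕ.<-irrefl refl)
Next-functional _   _    (inj₂ (_ , refl)) (inj₂ (_ , refl)) = refl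

Next-injective : ∀ {m q q′ p} → Next m q p → Next m q′ p → q ≡ q′
Next-injective (inj₁ refl)       (inj₁ eq)          = ℕ.suc-injective (sym eq)
Next-injective (inj₁ refl)       (inj₂ (_ , ()))
Next-injective (inj₂ (_ , refl)) (inj₁ ())
Next-injective (inj₂ (eq , _))   (inj₂ (eq′ , _))   = ℕ.suc-injective (trans eq (sym eq′))

blockKind : ℕ → ℕ → ℕ → Maybe BlockKind
blockKind m q p = if does (p ≟ q) then just diag else if does (next? m q p) then just next else nothing

blockKind-diag : ∀ m q → blockKind m q q ≡ just diag
blockKind-diag m q rewrite dec-true (q ≟ q) refl = refl

blockKind-next : ∀ {m q p} → p ≢ q → Next m q p → blockKind m q p ≡ just next
blockKind-next {m} {q} {p} p≢q p-next rewrite dec-false (p ≟ q) p≢q | dec-true (next? m q p) p-next = refl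

blockKind-nothing : ∀ {m q p} → p ≢ q → ¬ Next m q p → blockKind m q p ≡ nothing
blockKind-nothing {m} {q} {p} p≢q ¬next rewrite dec-false (p ≟ q) p≢q | dec-false (next? m q p) ¬next = refl

entryValue : ℕ → ℕ → Entry → ℤ
entryValue m q e = value e q (m ∸ suc q)

cell : ∀ m → Fin m → Fin 4 → Fin m → Fin 4 → Maybe ℤ
cell m Q ρ P π = Maybe.map (entryValue m (toℕ Q)) (blockKind m (toℕ Q) (toℕ P) >>= λ k → blockEntry k ρ π)

array : ∀ m → PArray (m * 4)
array m i j = cell m (quotient 4 i) (remainder {m} 4 i) (quotient 4 j) (remainder {m} 4 j)

blockRow : ∀ m → Fin m → Fin 4 → Fin m → List ℤ
blockRow m Q ρ P = catMaybes (tabulate (cell m Q ρ P))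

blockCol : ∀ m → Fin m → Fin 4 → Fin m → List ℤ
blockCol m P π Q = catMaybes (tabulate λ ρ → cell m Q ρ P π)

array-combine : ∀ m Q ρ P π → array m (combine Q ρ) (combine P π) ≡ cell m Q ρ P π
array-combine m Q ρ P π = cong₂ (λ i j → cell m (proj₁ i) (proj₂ i) (proj₁ j) (proj₂ j))
                                  (remQuot-combine {m} {4} Q ρ) (remQuot-combine {m} {4} P π)

row-array : ∀ m Q ρ → row (array m) (combine Q ρ) ≡ concat (tabulate (blockRow m Q ρ))
row-array m Q ρ = begin
  catMaybes (map (array m (combine Q ρ)) (allFin (m * 4)))
    ≡⟨ cong catMaybes (map-tabulate (λ i → i) (array m (combine Q ρ))) ⟩
  catMaybes (tabulate (array m (combine Q ρ)))
    ≡⟨ catMaybes-tabulate-combine m 4 (array m (combine Q ρ)) ⟩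
  concat (tabulate λ (P : Fin m) → catMaybes (tabulate λ (π : Fin 4) → array m (combine Q ρ) (combine P π)))
    ≡⟨ cong concat (tabulate-cong λ P → cong catMaybes (tabulate-cong (array-combine m Q ρ P))) ⟩
  concat (tabulate (blockRow m Q ρ)) ∎
  where open ≡-Reasoning

col-array : ∀ m P π → col (array m) (combine P π) ≡ concat (tabulate (blockCol m P π))
col-array m P π = begin
  catMaybes (map (λ i → array m i (combine P π)) (allFin (m * 4)))
    ≡⟨ cong catMaybes (map-tabulate (λ i → i) (λ i → array m i (combine P π))) ⟩
  catMaybes (tabulate λ i → array m i (combine P π))
    ≡⟨ catMaybes-tabulate-combine m 4 (λ i → array m i (combine P π)) ⟩
  concat (tabulate λ (Q : Fin m) → catMaybes (tabulate λ (ρ : Fin 4) → array m (combine Q ρ) (combine P π)))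
    ≡⟨ cong concat (tabulate-cong λ Q → cong catMaybes (tabulate-cong λ ρ → array-combine m Q ρ P π)) ⟩
  concat (tabulate (blockCol m P π)) ∎
  where open ≡-Reasoning

module _ {m} (Q P : Fin m) where

  private
    q = toℕ Q
    p = toℕ P
    f = entryValue m q

  blockRow-kind : ∀ {k} ρ → blockKind m q p ≡ just k → blockRow m Q ρ P ≡ map f (rowOf k ρ)
  blockRow-kind {k} ρ kind≡k = begin
    catMaybes (tabulate (cell m Q ρ P))
      ≡⟨ cong catMaybes (tabulate-cong λ π → cong (λ b → Maybe.map f (b >>= λ k → blockEntry k ρ π)) kind≡k) ⟩
    catMaybes (tabulate (Maybe.map f ∘ blockEntry k ρ))
      ≡⟨ cong catMaybes (map-tabulate (blockEntry k ρ) (Maybe.map f)) ⟨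
    catMaybes (map (Maybe.map f) (tabulate (blockEntry k ρ)))
      ≡⟨ map-catMaybes f (tabulate (blockEntry k ρ)) ⟨
    map f (rowOf k ρ) ∎
    where open ≡-Reasoning

  blockCol-kind : ∀ {k} π → blockKind m q p ≡ just k → blockCol m P π Q ≡ map f (colOf k π)
  blockCol-kind {k} π kind≡k = begin
    catMaybes (tabulate λ ρ → cell m Q ρ P π)
      ≡⟨ cong catMaybes (tabulate-cong λ ρ → cong (λ b → Maybe.map f (b >>= λ k → blockEntry k ρ π)) kind≡k) ⟩
    catMaybes (tabulate λ ρ → Maybe.map f (blockEntry k ρ π))
      ≡⟨ cong catMaybes (map-tabulate (λ ρ → blockEntry k ρ π) (Maybe.map f)) ⟨
    catMaybes (map (Maybe.map f) (tabulate λ ρ → blockEntry k ρ π))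
      ≡⟨ map-catMaybes f (tabulate λ ρ → blockEntry k ρ π) ⟨
    map f (colOf k π) ∎
    where open ≡-Reasoning

  blockRow-empty : ∀ ρ → blockKind m q p ≡ nothing → blockRow m Q ρ P ≡ []
  blockRow-empty ρ kind≡nothing =
    cong catMaybes (tabulate-cong λ π → cong (λ b → Maybe.map f (b >>= λ k → blockEntry k ρ π)) kind≡nothing)

  blockCol-empty : ∀ π → blockKind m q p ≡ nothing → blockCol m P π Q ≡ []
  blockCol-empty π kind≡nothing =
    cong catMaybes (tabulate-cong λ ρ → cong (λ b → Maybe.map f (b >>= λ k → blockEntry k ρ π)) kind≡nothing)

module _ {m} {Q P : Fin m} (P-next : Next m (toℕ Q) (toℕ P)) where

  private
    q = toℕ Q
    p = toℕ P

    blockRow-others : ∀ ρ z → z ≢ Q → z ≢ P → blockRow m Q ρ z ≡ []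
    blockRow-others ρ z z≢Q z≢P = blockRow-empty Q z ρ (blockKind-nothing (z≢Q ∘ toℕ-injective)
      λ z-next → z≢P (toℕ-injective (Next-functional (toℕ<n z) (toℕ<n P) z-next P-next)))

    blockCol-others : ∀ π z → z ≢ P → z ≢ Q → blockCol m P π z ≡ []
    blockCol-others π z z≢P z≢Q = blockCol-empty z P π (blockKind-nothing (z≢P ∘ toℕ-injective ∘ sym)
      λ z-next → z≢Q (toℕ-injective (Next-injective z-next P-next)))

  row-before : Q Fin.< P → ∀ ρ → row (array m) (combine Q ρ) ≡
               map (entryValue m q) (rowOf diag ρ) ++ map (entryValue m q) (rowOf next ρ)
  row-before Q<P ρ = begin
    row (array m) (combine Q ρ)          ≡⟨ row-array m Q ρ ⟩
    concat (tabulate (blockRow m Q ρ))   ≡⟨ concat-tabulate-pair (blockRow m Q ρ) Q<P (blockRow-others ρ) ⟩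
    blockRow m Q ρ Q ++ blockRow m Q ρ P ≡⟨ cong₂ _++_ (blockRow-kind Q Q ρ (blockKind-diag m q))
                                                        (blockRow-kind Q P ρ (blockKind-next (ℕ.>⇒≢ Q<P) P-next)) ⟩
    _ ∎
    where open ≡-Reasoning

  row-after : P Fin.< Q → ∀ ρ → row (array m) (combine Q ρ) ≡
              map (entryValue m q) (rowOf next ρ) ++ map (entryValue m q) (rowOf diag ρ)
  row-after P<Q ρ = begin
    row (array m) (combine Q ρ)          ≡⟨ row-array m Q ρ ⟩
    concat (tabulate (blockRow m Q ρ))   ≡⟨ concat-tabulate-pair (blockRow m Q ρ) P<Q
                                              (λ z z≢P z≢Q → blockRow-others ρ z z≢Q z≢P) ⟩
    blockRow m Q ρ P ++ blockRow m Q ρ Q ≡⟨ cong₂ _++_ (blockRow-kind Q P ρ (blockKind-next (ℕ.<⇒≢ P<Q) P-next))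
                                                        (blockRow-kind Q Q ρ (blockKind-diag m q)) ⟩
    _ ∎
    where open ≡-Reasoning

  col-before : Q Fin.< P → ∀ π → col (array m) (combine P π) ≡
               map (entryValue m q) (colOf next π) ++ map (entryValue m p) (colOf diag π)
  col-before Q<P π = begin
    col (array m) (combine P π)          ≡⟨ col-array m P π ⟩
    concat (tabulate (blockCol m P π))   ≡⟨ concat-tabulate-pair (blockCol m P π) Q<P
                                              (λ z z≢Q z≢P → blockCol-others π z z≢P z≢Q) ⟩
    blockCol m P π Q ++ blockCol m P π P ≡⟨ cong₂ _++_ (blockCol-kind Q P π (blockKind-next (ℕ.>⇒≢ Q<P) P-next))
                                                        (blockCol-kind P P π (blockKind-diag m p)) ⟩
    _ ∎
    where open ≡-Reasoning

  col-after : P Fin.< Q → ∀ π → col (array m) (combine P π) ≡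
              map (entryValue m p) (colOf diag π) ++ map (entryValue m q) (colOf next π)
  col-after P<Q π = begin
    col (array m) (combine P π)          ≡⟨ col-array m P π ⟩
    concat (tabulate (blockCol m P π))   ≡⟨ concat-tabulate-pair (blockCol m P π) P<Q (blockCol-others π) ⟩
    blockCol m P π P ++ blockCol m P π Q ≡⟨ cong₂ _++_ (blockCol-kind P P π (blockKind-diag m p))
                                                        (blockCol-kind Q P π (blockKind-next (ℕ.<⇒≢ P<Q) P-next)) ⟩
    _ ∎
    where open ≡-Reasoning

-- Rows and columns as values of forms

record Lin : Set where
  constructor lin
  field x y c : ℕ

⟦_⟧ₗ : Lin → ℕ → ℕ → ℕ
⟦ lin x y c ⟧ₗ X Y = x * X + y * Y + c

signed : Sign → Form → Form
signed Sign.+ f = f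
signed Sign.- f = ⊝ f

entryForm : Lin → Lin → Entry → Form
entryForm (lin qx qy q₀) (lin rx ry r₀) (entry s fam c) =
  signed s (form (+ (a * qx + b * rx)) (+ (a * qy + b * ry)) (+ (14 * (a * q₀ + b * r₀) + c)))
  where
  a = coeffQ fam
  b = coeffR fam

entryForm-sound : ∀ q r e X Y → ⟦ entryForm q r e ⟧ X Y ≡ value e (⟦ q ⟧ₗ X Y) (⟦ r ⟧ₗ X Y)
entryForm-sound (lin qx qy q₀) (lin rx ry r₀) (entry s fam c) X Y = signed-sound s
  where
  a = coeffQ fam
  b = coeffR fam
  unsigned = form (+ (a * qx + b * rx)) (+ (a * qy + b * ry)) (+ (14 * (a * q₀ + b * r₀) + c))
  size = magnitude (entry s fam c) (qx * X + qy * Y + q₀) (rx * X + ry * Y + r₀)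
  unsigned-sound : ⟦ unsigned ⟧ X Y ≡ + size
  unsigned-sound = trans (⟦⟧-ℕ (a * qx + b * rx) (a * qy + b * ry) (14 * (a * q₀ + b * r₀) + c) X Y)
                         (cong +_ (identity a b qx qy q₀ rx ry r₀ c X Y))
    where
    identity : ∀ a b qx qy q₀ rx ry r₀ c X Y →
      14 * ((a * qx + b * rx) * X + (a * qy + b * ry) * Y) + (14 * (a * q₀ + b * r₀) + c)
      ≡ 14 * (a * (qx * X + qy * Y + q₀) + b * (rx * X + ry * Y + r₀)) + c
    identity = solve-∀
  signed-sound : ∀ s → ⟦ signed s unsigned ⟧ X Y ≡ s ℤ.◃ size
  signed-sound Sign.+ = trans unsigned-sound (sym (ℤ.+◃n≡+n size))
  signed-sound Sign.- = trans (⟦⟧-⊝ unsigned X Y) (trans (cong ℤ.-_ unsigned-sound) (sym (ℤ.-◃n≡-n size)))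

-- The entries es of block row q followed by the entries es′ of block row q′, where r and r′
-- stand for m − 1 − q and m − 1 − q′.
lineForms : Lin → Lin → List Entry → Lin → Lin → List Entry → List Form
lineForms q r es q′ r′ es′ = map (entryForm q r) es ++ map (entryForm q′ r′) es′

values-lineForms : ∀ {m q₀ q₀′} q r es q′ r′ es′ X Y →
  ⟦ q ⟧ₗ X Y ≡ q₀ → ⟦ r ⟧ₗ X Y ≡ m ∸ suc q₀ → ⟦ q′ ⟧ₗ X Y ≡ q₀′ → ⟦ r′ ⟧ₗ X Y ≡ m ∸ suc q₀′ →
  values (lineForms q r es q′ r′ es′) X Y ≡ map (entryValue m q₀) es ++ map (entryValue m q₀′) es′
values-lineForms {m} {q₀} {q₀′} q r es q′ r′ es′ X Y q≡ r≡ q′≡ r′≡ = begin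
  values (map (entryForm q r) es ++ map (entryForm q′ r′) es′) X Y
    ≡⟨ map-++ _ (map (entryForm q r) es) (map (entryForm q′ r′) es′) ⟩
  values (map (entryForm q r) es) X Y ++ values (map (entryForm q′ r′) es′) X Y
    ≡⟨ cong₂ _++_ (sym (map-∘ es)) (sym (map-∘ es′)) ⟩
  map (λ e → ⟦ entryForm q r e ⟧ X Y) es ++ map (λ e → ⟦ entryForm q′ r′ e ⟧ X Y) es′
    ≡⟨ cong₂ _++_ (map-cong (λ e → trans (entryForm-sound q r e X Y) (cong₂ (value e) q≡ r≡)) es)
                  (map-cong (λ e → trans (entryForm-sound q′ r′ e X Y) (cong₂ (value e) q′≡ r′≡)) es′) ⟩
  map (entryValue m q₀) es ++ map (entryValue m q₀′) es′ ∎
  where open ≡-Reasoning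

𝐗 𝐗+1 𝐘 𝐘+1 𝟎ₗ : Lin
𝐗   = lin 1 0 0
𝐗+1 = lin 1 0 1
𝐘   = lin 0 1 0
𝐘+1 = lin 0 1 1
𝟎ₗ  = lin 0 0 0

⟦𝐗⟧ : ∀ X Y → ⟦ 𝐗 ⟧ₗ X Y ≡ X
⟦𝐗⟧ = identity
  where
  identity : ∀ X Y → 1 * X + 0 * Y + 0 ≡ X
  identity = solve-∀

⟦𝐗+1⟧ : ∀ X Y → ⟦ 𝐗+1 ⟧ₗ X Y ≡ suc X
⟦𝐗+1⟧ = identity
  where
  identity : ∀ X Y → 1 * X + 0 * Y + 1 ≡ suc X
  identity = solve-∀

⟦𝐘⟧ : ∀ X Y → ⟦ 𝐘 ⟧ₗ X Y ≡ Y
⟦𝐘⟧ = identity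
  where
  identity : ∀ X Y → 0 * X + 1 * Y + 0 ≡ Y
  identity = solve-∀

⟦𝐘+1⟧ : ∀ X Y → ⟦ 𝐘+1 ⟧ₗ X Y ≡ suc Y
⟦𝐘+1⟧ = identity
  where
  identity : ∀ X Y → 0 * X + 1 * Y + 1 ≡ suc Y
  identity = solve-∀

X+Y+2∸[1+X] : ∀ X Y → X + Y + 2 ∸ suc X ≡ suc Y
X+Y+2∸[1+X] X Y = trans (cong (_∸ suc X) (identity X Y)) (ℕ.m+n∸m≡n (suc X) (suc Y))
  where
  identity : ∀ X Y → X + Y + 2 ≡ suc X + suc Y
  identity = solve-∀

X+Y+2∸[2+X] : ∀ X Y → X + Y + 2 ∸ suc (suc X) ≡ Y
X+Y+2∸[2+X] X Y = trans (cong (_∸ suc (suc X)) (identity X Y)) (ℕ.m+n∸m≡n (suc (suc X)) Y)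
  where
  identity : ∀ X Y → X + Y + 2 ≡ suc (suc X) + Y
  identity = solve-∀

-- The four kinds of lines, for an array with m = X + Y + 2 block rows: a row of block row X,
-- a row of the last block row (Y = 0), a column of block column X + 1 and a column of block
-- column 0 (X = 0).
middleRow lastRow middleCol firstCol : Fin 4 → List Form
middleRow ρ = lineForms 𝐗   𝐘+1 (rowOf diag ρ) 𝐗   𝐘+1 (rowOf next ρ)
lastRow   ρ = lineForms 𝐗+1 𝟎ₗ  (rowOf next ρ) 𝐗+1 𝟎ₗ  (rowOf diag ρ)
middleCol π = lineForms 𝐗   𝐘+1 (colOf next π) 𝐗+1 𝐘   (colOf diag π)
firstCol  π = lineForms 𝟎ₗ  𝐘+1 (colOf diag π) 𝐘+1 𝟎ₗ  (colOf next π)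

bound : Form
bound = form (+ 4) (+ 4) (+ 112)

⟦bound⟧ : ∀ X Y → ⟦ bound ⟧ X Y ≡ + (2 * ((X + Y + 2) * 4) * 7)
⟦bound⟧ X Y = trans (⟦⟧-ℕ 4 4 112 X Y) (cong +_ (identity X Y))
  where
  identity : ∀ X Y → 14 * (4 * X + 4 * Y) + 112 ≡ 2 * ((X + Y + 2) * 4) * 7
  identity = solve-∀

CertifiedLine : List Form → Set
CertifiedLine fs = length fs ≡ 7 × Certified bound fs

certifiedLine? : ∀ fs → Dec (CertifiedLine fs)
certifiedLine? fs = (length fs ≟ 7) ×-dec certified? bound fs

middleRow-certified : ∀ ρ → CertifiedLine (middleRow ρ)
middleRow-certified = from-yes (all? (certifiedLine? ∘ middleRow))

lastRow-certified : ∀ ρ → CertifiedLine (lastRow ρ)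
lastRow-certified = from-yes (all? (certifiedLine? ∘ lastRow))

middleCol-certified : ∀ π → CertifiedLine (middleCol π)
middleCol-certified = from-yes (all? (certifiedLine? ∘ middleCol))

firstCol-certified : ∀ π → CertifiedLine (firstCol π)
firstCol-certified = from-yes (all? (certifiedLine? ∘ firstCol))

SHLine : ℕ → List ℤ → Set
SHLine n xs = length xs ≡ 7 × sumℤ xs ≡ 0ℤ ×
              SimpleMod (suc (2 * n * 7)) xs × SimpleMod (suc (suc (2 * n * 7))) xs

certified⇒SHLine : ∀ {m} fs X Y → m ≡ X + Y + 2 → CertifiedLine fs → SHLine (m * 4) (values fs X Y)
certified⇒SHLine fs X Y refl (length≡7 , certified) =
  trans (length-map _ fs) length≡7 ,
  certified⇒sum≡0 bound fs X Y certified ,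
  certified⇒simple bound fs X Y _ (⟦bound⟧ X Y) (ℕ.n<1+n _) certified ,
  certified⇒simple bound fs X Y _ (⟦bound⟧ X Y) (ℕ.m<n⇒m<1+n (ℕ.n<1+n _)) certified

module _ (k : ℕ) where

  private
    m : ℕ
    m = suc (suc k)

  next-inject₁-suc : ∀ (j : Fin (suc k)) → Next m (toℕ (inject₁ j)) (toℕ (suc j))
  next-inject₁-suc j = inj₁ (cong suc (toℕ-inject₁ j))

  next-last-zero : Next m (toℕ (fromℕ (suc k))) (toℕ (zero {suc k}))
  next-last-zero = inj₂ (cong suc (toℕ-fromℕ (suc k)) , refl)

  inject₁<suc : ∀ (j : Fin (suc k)) → inject₁ j Fin.< suc j
  inject₁<suc j = s≤s (ℕ.≤-reflexive (toℕ-inject₁ j))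

  zero<last : zero {suc k} Fin.< fromℕ (suc k)
  zero<last = subst (0 <_) (sym (toℕ-fromℕ (suc k))) (z<s {n = k})

  module _ (j : Fin (suc k)) where

    private
      X Y : ℕ
      X = toℕ j
      Y = k ∸ toℕ j
      m≡X+Y+2 : m ≡ X + Y + 2
      m≡X+Y+2 = trans (ℕ.+-comm 2 k) (cong (_+ 2) (sym (ℕ.m+[n∸m]≡n (ℕ.s≤s⁻¹ (toℕ<n j)))))
      m∸[1+q]≡1+Y : m ∸ suc (toℕ (inject₁ j)) ≡ suc Y
      m∸[1+q]≡1+Y = trans (cong (λ q → m ∸ suc q) (toℕ-inject₁ j)) (trans (cong (_∸ suc X) m≡X+Y+2) (X+Y+2∸[1+X] X Y))

    row-middle : ∀ (ρ : Fin 4) → SHLine (m * 4) (row (array m) (combine (inject₁ j) ρ))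
    row-middle ρ = subst (SHLine (m * 4)) (sym shape)
      (certified⇒SHLine (middleRow ρ) X Y m≡X+Y+2 (middleRow-certified ρ))
      where
      shape : row (array m) (combine (inject₁ j) ρ) ≡ values (middleRow ρ) X Y
      shape = trans (row-before {m} (next-inject₁-suc j) (inject₁<suc j) ρ)
        (sym (values-lineForms {m} 𝐗 𝐘+1 (rowOf diag ρ) 𝐗 𝐘+1 (rowOf next ρ) X Y
          (trans (⟦𝐗⟧ X Y) (sym (toℕ-inject₁ j))) (trans (⟦𝐘+1⟧ X Y) (sym m∸[1+q]≡1+Y))
          (trans (⟦𝐗⟧ X Y) (sym (toℕ-inject₁ j))) (trans (⟦𝐘+1⟧ X Y) (sym m∸[1+q]≡1+Y))))

    col-middle : ∀ (π : Fin 4) → SHLine (m * 4) (col (array m) (combine (suc j) π))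
    col-middle π = subst (SHLine (m * 4)) (sym shape)
      (certified⇒SHLine (middleCol π) X Y m≡X+Y+2 (middleCol-certified π))
      where
      shape : col (array m) (combine (suc j) π) ≡ values (middleCol π) X Y
      shape = trans (col-before {m} (next-inject₁-suc j) (inject₁<suc j) π)
        (sym (values-lineForms {m} 𝐗 𝐘+1 (colOf next π) 𝐗+1 𝐘 (colOf diag π) X Y
          (trans (⟦𝐗⟧ X Y) (sym (toℕ-inject₁ j))) (trans (⟦𝐘+1⟧ X Y) (sym m∸[1+q]≡1+Y))
          (⟦𝐗+1⟧ X Y) (trans (⟦𝐘⟧ X Y) (sym (trans (cong (_∸ suc (suc X)) m≡X+Y+2) (X+Y+2∸[2+X] X Y))))))

  private
    q-last : suc k ≡ toℕ (fromℕ (suc k))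
    q-last = sym (toℕ-fromℕ (suc k))
    r-last : 0 ≡ m ∸ suc (toℕ (fromℕ (suc k)))
    r-last = sym (trans (cong (λ q → m ∸ suc q) (toℕ-fromℕ (suc k))) (ℕ.n∸n≡0 m))

  row-last : ∀ (ρ : Fin 4) → SHLine (m * 4) (row (array m) (combine (fromℕ (suc k)) ρ))
  row-last ρ = subst (SHLine (m * 4)) (sym shape)
    (certified⇒SHLine (lastRow ρ) k 0 m≡k+0+2 (lastRow-certified ρ))
    where
    m≡k+0+2 : m ≡ k + 0 + 2
    m≡k+0+2 = trans (ℕ.+-comm 2 k) (cong (_+ 2) (sym (ℕ.+-identityʳ k)))
    shape : row (array m) (combine (fromℕ (suc k)) ρ) ≡ values (lastRow ρ) k 0
    shape = trans (row-after {m} next-last-zero zero<last ρ)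
      (sym (values-lineForms {m} 𝐗+1 𝟎ₗ (rowOf next ρ) 𝐗+1 𝟎ₗ (rowOf diag ρ) k 0
        (trans (⟦𝐗+1⟧ k 0) q-last) r-last (trans (⟦𝐗+1⟧ k 0) q-last) r-last))

  col-first : ∀ (π : Fin 4) → SHLine (m * 4) (col (array m) (combine (zero {suc k}) π))
  col-first π = subst (SHLine (m * 4)) (sym shape)
    (certified⇒SHLine (firstCol π) 0 k (ℕ.+-comm 2 k) (firstCol-certified π))
    where
    shape : col (array m) (combine (zero {suc k}) π) ≡ values (firstCol π) 0 k
    shape = trans (col-after {m} next-last-zero zero<last π)
      (sym (values-lineForms {m} 𝟎ₗ 𝐘+1 (colOf diag π) 𝐘+1 𝟎ₗ (colOf next π) 0 k
        refl (⟦𝐘+1⟧ 0 k) (trans (⟦𝐘+1⟧ 0 k) q-last) r-last))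

-- Decoding magnitudes

lowResidues twoQResidues : List ℕ
lowResidues  = 2 ∷ 3 ∷ 4 ∷ 5 ∷ 6 ∷ 7 ∷ 9 ∷ 13 ∷ []
twoQResidues = 14 ∷ 24 ∷ 26 ∷ 28 ∷ []

-- The residues c for which decode recovers c and q from a magnitude of the given family.
Admissible : Family → ℕ → Set
Admissible _      zero    = ⊥
Admissible oneQ   (suc j) = j < 14 × suc j ∈ lowResidues
Admissible twoQ+R (suc j) = 14 ≤ j × j < 28 × j ∸ 13 ∈ lowResidues
Admissible twoQ   (suc i) = i < 28 × suc (i % 14) ∉ lowResidues × suc i ∈ twoQResidues
Admissible twoR   (suc i) = i < 28 × suc (i % 14) ∉ lowResidues × suc i ∉ twoQResidues

admissible? : ∀ f c → Dec (Admissible f c)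
admissible? _      zero    = no λ ()
admissible? oneQ   (suc j) = (j <? 14) ×-dec (suc j ∈? lowResidues)
admissible? twoQ+R (suc j) = (14 ≤? j) ×-dec (j <? 28) ×-dec (j ∸ 13 ∈? lowResidues)
admissible? twoQ   (suc i) = (i <? 28) ×-dec ¬? (suc (i % 14) ∈? lowResidues) ×-dec (suc i ∈? twoQResidues)
admissible? twoR   (suc i) = (i <? 28) ×-dec ¬? (suc (i % 14) ∈? lowResidues) ×-dec ¬? (suc i ∈? twoQResidues)

decodeParts : ℕ → ℕ → ℕ → ℕ → ℕ → ℕ × ℕ
decodeParts m j t i s =
  if does (suc j ∈? lowResidues)
  then (if does (t <? m) then (suc j , t) else (15 + j , t ∸ m))
  else (if does (suc i ∈? twoQResidues) then (suc i , s) else (suc i , m ∸ suc s))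

-- decode m v recovers (c, q) from v = 14 (a q + b r) + c − 1. The residues c of oneQ and twoQ+R
-- are those with c mod 14 in lowResidues; these two kinds are told apart by v div 14 < m. For
-- twoQ and twoR, c is read off v mod 28 and q or r off v div 28.
decode : ℕ → ℕ → ℕ × ℕ
decode m v = decodeParts m (v % 14) (v / 14) (v % 28) (v / 28)

[j+td]%d≡j : ∀ j t d .{{_ : NonZero d}} → j < d → (j + t * d) % d ≡ j
[j+td]%d≡j j t d j<d = trans ([m+kn]%n≡m%n j t d) (m<n⇒m%n≡m j<d)

[j+td]/d≡t : ∀ j t d .{{_ : NonZero d}} → j < d → (j + t * d) / d ≡ t
[j+td]/d≡t j t d j<d = trans (+-distrib-/-∣ʳ j (divides-refl t)) (cong₂ _+_ (m<n⇒m/n≡0 j<d) (m*n/n≡m t d))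

decode-14 : ∀ m j t → j < 14 →
            decode m (j + t * 14) ≡ decodeParts m j t ((j + t * 14) % 28) ((j + t * 14) / 28)
decode-14 m j t j<14 = cong₂ (λ a b → decodeParts m a b ((j + t * 14) % 28) ((j + t * 14) / 28))
                             ([j+td]%d≡j j t 14 j<14) ([j+td]/d≡t j t 14 j<14)

[i+28s]%14≡i%14 : ∀ i s → (i + s * 28) % 14 ≡ i % 14
[i+28s]%14≡i%14 i s = trans (cong (λ x → (i + x) % 14) (sym (ℕ.*-assoc s 2 14))) ([m+kn]%n≡m%n i (s * 2) 14)

decode-28 : ∀ m i s → i < 28 → decode m (i + s * 28) ≡ decodeParts m (i % 14) ((i + s * 28) / 14) i s
decode-28 m i s i<28
  rewrite [i+28s]%14≡i%14 i s | [j+td]%d≡j i s 28 i<28 | [j+td]/d≡t i s 28 i<28 = refl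

module _ {m j t i s : ℕ} where

  decodeParts-oneQ : suc j ∈ lowResidues → t < m → decodeParts m j t i s ≡ (suc j , t)
  decodeParts-oneQ low t<m rewrite dec-true (suc j ∈? lowResidues) low | dec-true (t <? m) t<m = refl

  decodeParts-twoQ+R : suc j ∈ lowResidues → ¬ t < m → decodeParts m j t i s ≡ (15 + j , t ∸ m)
  decodeParts-twoQ+R low t≮m rewrite dec-true (suc j ∈? lowResidues) low | dec-false (t <? m) t≮m = refl

  decodeParts-twoQ : suc j ∉ lowResidues → suc i ∈ twoQResidues → decodeParts m j t i s ≡ (suc i , s)
  decodeParts-twoQ ¬low even
    rewrite dec-false (suc j ∈? lowResidues) ¬low | dec-true (suc i ∈? twoQResidues) even = refl

  decodeParts-twoR : suc j ∉ lowResidues → suc i ∉ twoQResidues → decodeParts m j t i s ≡ (suc i , m ∸ suc s)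
  decodeParts-twoR ¬low ¬even
    rewrite dec-false (suc j ∈? lowResidues) ¬low | dec-false (suc i ∈? twoQResidues) ¬even = refl

x+[1+c]∸1≡x+c : ∀ x c → x + suc c ∸ 1 ≡ x + c
x+[1+c]∸1≡x+c x c = cong (_∸ 1) (ℕ.+-suc x c)

decode-oneQ : ∀ m s j q → Admissible oneQ (suc j) → q < m →
              decode m (magnitude (entry s oneQ (suc j)) q (m ∸ suc q) ∸ 1) ≡ (suc j , q)
decode-oneQ m s j q (j<14 , low) q<m = begin
  decode m (14 * (1 * q + 0 * r) + suc j ∸ 1)
    ≡⟨ cong (decode m) (trans (x+[1+c]∸1≡x+c (14 * (1 * q + 0 * r)) j) (identity q r j)) ⟩
  decode m (j + q * 14)                         ≡⟨ decode-14 m j q j<14 ⟩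
  decodeParts m j q _ _                         ≡⟨ decodeParts-oneQ low q<m ⟩
  (suc j , q)                                   ∎
  where
  open ≡-Reasoning
  r = m ∸ suc q
  identity : ∀ q r j → 14 * (1 * q + 0 * r) + j ≡ j + q * 14
  identity = solve-∀

decode-twoQ+R : ∀ m s j q → Admissible twoQ+R (suc j) → q < m →
                decode m (magnitude (entry s twoQ+R (suc j)) q (m ∸ suc q) ∸ 1) ≡ (suc j , q)
decode-twoQ+R m s j q (14≤j , j<28 , low) q<m = begin
  decode m (14 * (2 * q + 1 * r) + suc j ∸ 1)
    ≡⟨ cong (decode m) (trans (x+[1+c]∸1≡x+c (14 * (2 * q + 1 * r)) j) v≡) ⟩
  decode m (j₀ + (q + m) * 14)                 ≡⟨ decode-14 m j₀ (q + m) j₀<14 ⟩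
  decodeParts m j₀ (q + m) _ _                 ≡⟨ decodeParts-twoQ+R low′ (ℕ.m+n≮n q m) ⟩
  (15 + j₀ , q + m ∸ m)                        ≡⟨ cong₂ _,_ (cong suc 14+j₀≡j) (ℕ.m+n∸n≡m q m) ⟩
  (suc j , q)                                  ∎
  where
  open ≡-Reasoning
  r = m ∸ suc q
  j₀ = j ∸ 14
  14+j₀≡j : 14 + j₀ ≡ j
  14+j₀≡j = ℕ.m+[n∸m]≡n 14≤j
  j₀<14 : j₀ < 14
  j₀<14 = ℕ.+-cancelˡ-< 14 j₀ 14 (subst (_< 28) (sym 14+j₀≡j) j<28)
  low′ : suc j₀ ∈ lowResidues
  low′ = subst (_∈ lowResidues) (cong (_∸ 13) (sym 14+j₀≡j)) low
  identity : ∀ q r j₀ → 14 * (2 * q + 1 * r) + (14 + j₀) ≡ j₀ + (q + suc (q + r)) * 14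
  identity = solve-∀
  v≡ : 14 * (2 * q + 1 * r) + j ≡ j₀ + (q + m) * 14
  v≡ = begin
    14 * (2 * q + 1 * r) + j         ≡⟨ cong (λ x → 14 * (2 * q + 1 * r) + x) (sym 14+j₀≡j) ⟩
    14 * (2 * q + 1 * r) + (14 + j₀) ≡⟨ identity q r j₀ ⟩
    j₀ + (q + suc (q + r)) * 14      ≡⟨ cong (λ x → j₀ + (q + x) * 14) (ℕ.m+[n∸m]≡n q<m) ⟩
    j₀ + (q + m) * 14                ∎

decode-twoQ : ∀ m s i q → Admissible twoQ (suc i) → q < m →
              decode m (magnitude (entry s twoQ (suc i)) q (m ∸ suc q) ∸ 1) ≡ (suc i , q)
decode-twoQ m s i q (i<28 , ¬low , even) q<m = begin
  decode m (14 * (2 * q + 0 * r) + suc i ∸ 1)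
    ≡⟨ cong (decode m) (trans (x+[1+c]∸1≡x+c (14 * (2 * q + 0 * r)) i) (identity q r i)) ⟩
  decode m (i + q * 28)                         ≡⟨ decode-28 m i q i<28 ⟩
  decodeParts m (i % 14) ((i + q * 28) / 14) i q
    ≡⟨ decodeParts-twoQ {m} {i % 14} {(i + q * 28) / 14} {i} {q} ¬low even ⟩
  (suc i , q)                                   ∎
  where
  open ≡-Reasoning
  r = m ∸ suc q
  identity : ∀ q r i → 14 * (2 * q + 0 * r) + i ≡ i + q * 28
  identity = solve-∀

decode-twoR : ∀ m s i q → Admissible twoR (suc i) → q < m →
              decode m (magnitude (entry s twoR (suc i)) q (m ∸ suc q) ∸ 1) ≡ (suc i , q)
decode-twoR m s i q (i<28 , ¬low , ¬even) q<m = begin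
  decode m (14 * (0 * q + 2 * r) + suc i ∸ 1)
    ≡⟨ cong (decode m) (trans (x+[1+c]∸1≡x+c (14 * (0 * q + 2 * r)) i) (identity q r i)) ⟩
  decode m (i + r * 28)                         ≡⟨ decode-28 m i r i<28 ⟩
  decodeParts m (i % 14) ((i + r * 28) / 14) i r
    ≡⟨ decodeParts-twoR {m} {i % 14} {(i + r * 28) / 14} {i} {r} ¬low ¬even ⟩
  (suc i , m ∸ suc r)                           ≡⟨ cong (suc i ,_) m∸[1+r]≡q ⟩
  (suc i , q)                                   ∎
  where
  open ≡-Reasoning
  r = m ∸ suc q
  identity : ∀ q r i → 14 * (0 * q + 2 * r) + i ≡ i + r * 28
  identity = solve-∀
  m∸[1+r]≡q : m ∸ suc r ≡ q
  m∸[1+r]≡q = trans (cong (_∸ suc r) (sym (ℕ.m+[n∸m]≡n q<m))) (ℕ.m+n∸n≡m q r)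

decode-magnitude : ∀ m e q → Admissible (Entry.family e) (Entry.residue e) → q < m →
                   decode m (magnitude e q (m ∸ suc q) ∸ 1) ≡ (Entry.residue e , q)
decode-magnitude m (entry s oneQ   (suc c)) q = decode-oneQ   m s c q
decode-magnitude m (entry s twoQ+R (suc c)) q = decode-twoQ+R m s c q
decode-magnitude m (entry s twoQ   (suc c)) q = decode-twoQ   m s c q
decode-magnitude m (entry s twoR   (suc c)) q = decode-twoR   m s c q

-- Distinct absolute values and the range of the entries

Slot : Set
Slot = BlockKind × Fin 4 × Fin 4

_≟ₖ_ : DecidableEquality BlockKind
diag ≟ₖ diag = yes refl
diag ≟ₖ next = no λ ()
next ≟ₖ diag = no λ ()
next ≟ₖ next = yes refl

_≟ₛ_ : DecidableEquality Slot
_≟ₛ_ = Product.≡-dec _≟ₖ_ (Product.≡-dec _≟ᶠ_ _≟ᶠ_)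

slots : List Slot
slots = cartesianProduct (diag ∷ next ∷ []) (cartesianProduct (allFin 4) (allFin 4))

slotEntry : Slot → Maybe Entry
slotEntry (k , ρ , π) = blockEntry k ρ π

slotOf : ℕ → Maybe Slot
slotOf c = find (λ s → Maybe.≡-dec ℕ._≟_ (Maybe.map Entry.residue (slotEntry s)) (just c)) slots

Decodable : Entry → Slot → Set
Decodable e s = Admissible (Entry.family e) (Entry.residue e) × slotOf (Entry.residue e) ≡ just s

decodable? : ∀ s → Dec (AllMaybe (λ e → Decodable e s) (slotEntry s))
decodable? s = AllMaybe.dec (λ e → admissible? (Entry.family e) (Entry.residue e) ×-dec
                                   Maybe.≡-dec _≟ₛ_ (slotOf (Entry.residue e)) (just s)) (slotEntry s)

blockEntry-decodable : ∀ k ρ π → AllMaybe (λ e → Decodable e (k , ρ , π)) (blockEntry k ρ π)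
blockEntry-decodable diag = from-yes (all? λ ρ → all? λ π → decodable? (diag , ρ , π))
blockEntry-decodable next = from-yes (all? λ ρ → all? λ π → decodable? (next , ρ , π))

Position : BlockKind → ℕ → ℕ → ℕ → Set
Position diag m q p = p ≡ q
Position next m q p = Next m q p

blockKind-position : ∀ m q p {k} → blockKind m q p ≡ just k → Position k m q p
blockKind-position m q p kind≡ with p ℕ.≟ q
... | yes refl with refl ← trans (sym (blockKind-diag m q)) kind≡ = refl
... | no p≢q with next? m q p
...   | yes p-next with refl ← trans (sym (blockKind-next p≢q p-next)) kind≡ = p-next
...   | no ¬p-next with () ← trans (sym (blockKind-nothing p≢q ¬p-next)) kind≡

position-functional : ∀ {k m q p p′} → p < m → p′ < m → Position k m q p → Position k m q p′ → p ≡ p′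
position-functional {diag} _ _ p≡q p′≡q = trans p≡q (sym p′≡q)
position-functional {next} p<m p′<m p-next p′-next = Next-functional p<m p′<m p-next p′-next

record Occupied (m : ℕ) (Q : Fin m) (ρ : Fin 4) (P : Fin m) (π : Fin 4) (a : ℤ) : Set where
  field
    kind   : BlockKind
    occupant : Entry
    kind≡  : blockKind m (toℕ Q) (toℕ P) ≡ just kind
    entry≡ : blockEntry kind ρ π ≡ just occupant
    value≡ : entryValue m (toℕ Q) occupant ≡ a

  decodable : Decodable occupant (kind , ρ , π)
  decodable
    with just d ← subst (AllMaybe (λ e → Decodable e (kind , ρ , π))) entry≡ (blockEntry-decodable kind ρ π) = d

  ∣a∣≡magnitude : ∣ a ∣ ≡ magnitude occupant (toℕ Q) (m ∸ suc (toℕ Q))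
  ∣a∣≡magnitude = trans (cong ∣_∣ (sym value≡)) (ℤ.abs-◃ _ _)

cell-occupied : ∀ m Q ρ P π {a} → cell m Q ρ P π ≡ just a → Occupied m Q ρ P π a
cell-occupied m Q ρ P π cell≡a with blockKind m (toℕ Q) (toℕ P) in kind≡
... | nothing with () ← cell≡a
... | just k with blockEntry k ρ π in entry≡
...   | nothing with () ← cell≡a
...   | just e with refl ← cell≡a =
  record { kind = k ; occupant = e ; kind≡ = kind≡ ; entry≡ = entry≡ ; value≡ = refl }

cell-injective : ∀ {m Q ρ P π Q′ ρ′ P′ π′ a b} → cell m Q ρ P π ≡ just a → cell m Q′ ρ′ P′ π′ ≡ just b →
                 ∣ a ∣ ≡ ∣ b ∣ → (Q , ρ) ≡ (Q′ , ρ′) × (P , π) ≡ (P′ , π′)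
cell-injective {m} {Q} {ρ} {P} {π} {Q′} {ρ′} {P′} {π′} cell≡a cell≡b ∣a∣≡∣b∣ =
  cong₂ _,_ (toℕ-injective q≡q′) (cong (proj₁ ∘ proj₂) slot≡) ,
  cong₂ _,_ (toℕ-injective p≡p′) (cong (proj₂ ∘ proj₂) slot≡)
  where
  o  = cell-occupied m Q ρ P π cell≡a
  o′ = cell-occupied m Q′ ρ′ P′ π′ cell≡b
  open Occupied o using (occupant; decodable; ∣a∣≡magnitude)
  open Occupied o′ using () renaming (occupant to occupant′; decodable to decodable′; ∣a∣≡magnitude to ∣b∣≡magnitude)
  decoded : (Entry.residue occupant , toℕ Q) ≡ (Entry.residue occupant′ , toℕ Q′)
  decoded = begin
    (Entry.residue occupant , toℕ Q)
      ≡⟨ decode-magnitude m occupant (toℕ Q) (proj₁ decodable) (toℕ<n Q) ⟨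
    decode m (magnitude occupant (toℕ Q) (m ∸ suc (toℕ Q)) ∸ 1)
      ≡⟨ cong (λ x → decode m (x ∸ 1)) (trans (sym ∣a∣≡magnitude) (trans ∣a∣≡∣b∣ ∣b∣≡magnitude)) ⟩
    decode m (magnitude occupant′ (toℕ Q′) (m ∸ suc (toℕ Q′)) ∸ 1)
      ≡⟨ decode-magnitude m occupant′ (toℕ Q′) (proj₁ decodable′) (toℕ<n Q′) ⟩
    (Entry.residue occupant′ , toℕ Q′) ∎
    where open ≡-Reasoning
  q≡q′ : toℕ Q ≡ toℕ Q′
  q≡q′ = cong proj₂ decoded
  slot≡ : (Occupied.kind o , ρ , π) ≡ (Occupied.kind o′ , ρ′ , π′)
  slot≡ = Maybe.just-injective (trans (sym (proj₂ decodable))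
            (trans (cong (slotOf ∘ proj₁) decoded) (proj₂ decodable′)))
  p≡p′ : toℕ P ≡ toℕ P′
  p≡p′ = position-functional (toℕ<n P) (toℕ<n P′)
    (blockKind-position m (toℕ Q) (toℕ P) (Occupied.kind≡ o))
    (subst₂ (λ k q → Position k m q (toℕ P′)) (sym (cong proj₁ slot≡)) (sym q≡q′)
      (blockKind-position m (toℕ Q′) (toℕ P′) (Occupied.kind≡ o′)))

admissible⇒1≤c≤28 : ∀ f c → Admissible f c → 1 ≤ c × c ≤ 28
admissible⇒1≤c≤28 oneQ   (suc j) (j<14 , _)     = s≤s z≤n , ℕ.≤-trans j<14 (ℕ.m≤m+n 14 14)
admissible⇒1≤c≤28 twoQ+R (suc j) (_ , j<28 , _) = s≤s z≤n , j<28
admissible⇒1≤c≤28 twoQ   (suc i) (i<28 , _)     = s≤s z≤n , i<28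
admissible⇒1≤c≤28 twoR   (suc i) (i<28 , _)     = s≤s z≤n , i<28

coeffQ≤2 : ∀ f → coeffQ f ≤ 2
coeffQ≤2 twoQ   = ℕ.≤-refl
coeffQ≤2 twoR   = z≤n
coeffQ≤2 oneQ   = s≤s z≤n
coeffQ≤2 twoQ+R = ℕ.≤-refl

coeffR≤2 : ∀ f → coeffR f ≤ 2
coeffR≤2 twoQ   = z≤n
coeffR≤2 twoR   = ℕ.≤-refl
coeffR≤2 oneQ   = z≤n
coeffR≤2 twoQ+R = s≤s z≤n

magnitude-bounds : ∀ e q r → Admissible (Entry.family e) (Entry.residue e) →
                   1 ≤ magnitude e q r × magnitude e q r ≤ 28 * suc (q + r)
magnitude-bounds (entry _ f c) q r admissible =
  ℕ.≤-trans 1≤c (ℕ.m≤n+m c x) ,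
  ℕ.≤-trans (ℕ.+-mono-≤ (ℕ.*-monoʳ-≤ 14 (ℕ.+-mono-≤ (ℕ.*-monoˡ-≤ q (coeffQ≤2 f)) (ℕ.*-monoˡ-≤ r (coeffR≤2 f))))
                        c≤28)
            (ℕ.≤-reflexive (identity q r))
  where
  x = 14 * (coeffQ f * q + coeffR f * r)
  1≤c = proj₁ (admissible⇒1≤c≤28 f c admissible)
  c≤28 = proj₂ (admissible⇒1≤c≤28 f c admissible)
  identity : ∀ q r → 14 * (2 * q + 2 * r) + 28 ≡ 28 * suc (q + r)
  identity = solve-∀

cell-range : ∀ {m Q ρ P π a} → cell m Q ρ P π ≡ just a → 1 ≤ ∣ a ∣ × ∣ a ∣ ≤ m * 4 * 7
cell-range {m} {Q} {ρ} {P} {π} cell≡a =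
  subst (1 ≤_) (sym ∣a∣≡magnitude) (proj₁ bounds) ,
  subst (_≤ m * 4 * 7) (sym ∣a∣≡magnitude) (ℕ.≤-trans (proj₂ bounds) (ℕ.≤-reflexive 28[q+r+1]≡m*4*7))
  where
  open Occupied (cell-occupied m Q ρ P π cell≡a) using (occupant; decodable; ∣a∣≡magnitude)
  q = toℕ Q
  bounds = magnitude-bounds occupant q (m ∸ suc q) (proj₁ decodable)
  28[q+r+1]≡m*4*7 : 28 * suc (q + (m ∸ suc q)) ≡ m * 4 * 7
  28[q+r+1]≡m*4*7 = trans (cong (28 *_) (ℕ.m+[n∸m]≡n (toℕ<n Q))) (identity m)
    where
    identity : ∀ m → 28 * m ≡ m * 4 * 7
    identity = solve-∀

remQuot-injective : ∀ {m n} {i j : Fin (m * n)} → remQuot {m} n i ≡ remQuot n j → i ≡ j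
remQuot-injective {m} {n} {i} {j} eq =
  trans (sym (combine-remQuot {m} n i)) (trans (cong (uncurry combine) eq) (combine-remQuot {m} n j))

module _ (k : ℕ) where

  private
    m : ℕ
    m = suc (suc k)

  rows-SHLine : ∀ i → SHLine (m * 4) (row (array m) i)
  rows-SHLine i = subst (SHLine (m * 4) ∘ row (array m)) (combine-remQuot {m} 4 i)
                        (block-rows (quotient 4 i) (remainder {m} 4 i))
    where
    block-rows : ∀ Q ρ → SHLine (m * 4) (row (array m) (combine Q ρ))
    block-rows Q ρ with view Q
    ... | ‵fromℕ        = row-last k ρ
    ... | ‵inj₁ {i = j} _ = row-middle k j ρ

  cols-SHLine : ∀ j → SHLine (m * 4) (col (array m) j)
  cols-SHLine j = subst (SHLine (m * 4) ∘ col (array m)) (combine-remQuot {m} 4 j)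
                        (block-cols (quotient 4 j) (remainder {m} 4 j))
    where
    block-cols : ∀ P π → SHLine (m * 4) (col (array m) (combine P π))
    block-cols zero    π = col-first k π
    block-cols (suc j) π = col-middle k j π

  array-SHStar : IsSHStar (m * 4) 7 (array m)
  array-SHStar = record
    { isH = record
      { entryRange  = λ i j _ → cell-range {m} {Q i} {ρ i} {Q j} {ρ j}
      ; absDistinct = λ i j i′ j′ _ _ cell≡a cell≡b ∣a∣≡∣b∣ →
          let same-row , same-col = cell-injective {m} {Q i} {ρ i} {Q j} {ρ j} {Q i′} {ρ i′} {Q j′} {ρ j′}
                                                   cell≡a cell≡b ∣a∣≡∣b∣
          in remQuot-injective same-row , remQuot-injective same-col
      ; rowCount    = proj₁ ∘ rows-SHLine
      ; colCount    = proj₁ ∘ cols-SHLine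
      ; rowSum      = proj₁ ∘ proj₂ ∘ rows-SHLine
      ; colSum      = proj₁ ∘ proj₂ ∘ cols-SHLine
      }
    ; rowSimple₁ = proj₁ ∘ proj₂ ∘ proj₂ ∘ rows-SHLine
    ; rowSimple₂ = proj₂ ∘ proj₂ ∘ proj₂ ∘ rows-SHLine
    ; colSimple₁ = proj₁ ∘ proj₂ ∘ proj₂ ∘ cols-SHLine
    ; colSimple₂ = proj₂ ∘ proj₂ ∘ proj₂ ∘ cols-SHLine
    }
    where
    Q : Fin (m * 4) → Fin m
    Q = quotient 4
    ρ : Fin (m * 4) → Fin 4
    ρ = remainder {m} 4

proposition4p3 : (n : ℕ) → 4 ∣ n → 8 ≤ n → Σ (PArray n) (IsSHStar n 7)
proposition4p3 _ (divides 0 refl) ()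
proposition4p3 _ (divides 1 refl) (s≤s (s≤s (s≤s (s≤s ()))))
proposition4p3 _ (divides (suc (suc k)) refl) _ = array (suc (suc k)) , array-SHStar k
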